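{- Let $v_1=v_1(z)$ be the unique root of $z u^3+(z^2-1)u^2-z^3u+z^2=0$ that is a formal Laurent series in $z$ of the form $v_1=\frac1z-z-z^5-2z^7-\cdots$. For $n\ge1$, let $d_n$ be the number of Dyck paths of semilength $n$ in which every descent that does not end on the $x$-axis has odd length (descents ending on the $x$-axis may have any length). Then $$\sum_{n\ge1}d_nz^{2n}=\frac{z^2v_1}{v_1(1-z^2)-z},$$ and with $Z=z^2$ this equals $Z+2Z^2+5Z^3+13Z^4+35Z^5+97Z^6+274Z^7+785Z^8+\cdots$.
   Context: A Dyck path is a nonempty finite sequence of up-steps $(1,1)$ and down-steps $(1,-1)$ starting at the origin, never going below the $x$-axis and ending on the $x$-axis. A descent is a maximal run of consecutive down-steps; its length is the number of down-steps in it. -}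

module Defs where

open import Data.Nat as ℕ using (ℕ; zero; suc; _∸_; _≡ᵇ_; _<ᵇ_)
open import Data.Integer as ℤ using (ℤ; +_; -[1+_])
open import Data.Bool using (Bool; true; false; _∧_; _∨_; if_then_else_)
open import Data.List using (List; []; _∷_; [_]; length; filterᵇ; concatMap)
open import Relation.Binary.PropositionalEquality using (_≡_)
open import Data.Product using (_×_)

data Step : Set where
  U D : Step    -- U = up-step (1,1), D = down-step (1,-1)

oddᵇ : ℕ → Bool
oddᵇ zero          = false
oddᵇ (suc zero)    = true
oddᵇ (suc (suc n)) = oddᵇ n

words : ℕ → List (List Step)
words zero    = [ [] ]
words (suc k) = concatMap (λ w → (U ∷ w) ∷ (D ∷ w) ∷ []) (words k)

dyckFrom : ℕ → List Step → Bool
dyckFrom h       []      = h ≡ᵇ 0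
dyckFrom h       (U ∷ s) = dyckFrom (suc h) s
dyckFrom zero    (D ∷ s) = false
dyckFrom (suc h) (D ∷ s) = dyckFrom h s

isDyck : List Step → Bool
isDyck = dyckFrom 0

-- goodFrom h s : every descent (maximal run of D's) of s, which is read
-- starting from height h, either ends on the x-axis or has odd length.
-- inRun h ℓ s : we are inside a descent, currently at height h, having
-- already taken ℓ down-steps of it.
mutual
  goodFrom : ℕ → List Step → Bool
  goodFrom h []      = true
  goodFrom h (U ∷ s) = goodFrom (suc h) s
  goodFrom h (D ∷ s) = inRun (h ∸ 1) 1 s

  inRun : ℕ → ℕ → List Step → Bool
  inRun h ℓ (D ∷ s) = inRun (h ∸ 1) (suc ℓ) s
  inRun h ℓ []      = (h ≡ᵇ 0) ∨ oddᵇ ℓ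
  inRun h ℓ (U ∷ s) = ((h ≡ᵇ 0) ∨ oddᵇ ℓ) ∧ goodFrom (suc h) s

oddDescents : List Step → Bool
oddDescents = goodFrom 0

d : ℕ → ℕ
d n = length (filterᵇ (λ w → isDyck w ∧ oddDescents w) (words (n ℕ.+ n)))

-- Formal Laurent series over ℤ (with finitely many negative powers).
-- laurent k f  represents  Σ_{i ≥ 0} f i · z^(i - k).

record Laurent : Set where
  constructor laurent
  field
    ord   : ℕ
    coeff : ℕ → ℤ
open Laurent public

coeffAt : Laurent → ℤ → ℤ
coeffAt (laurent k f) m with m ℤ.+ + k
... | + i     = f i
... | -[1+ _ ] = + 0

infix 4 _≈_
_≈_ : Laurent → Laurent → Set
L ≈ M = ∀ m → coeffAt L m ≡ coeffAt M m

sumTo : ℕ → (ℕ → ℤ) → ℤ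
sumTo zero    f = f 0
sumTo (suc n) f = sumTo n f ℤ.+ f (suc n)

shiftBy : ℕ → (ℕ → ℤ) → ℕ → ℤ
shiftBy j f i = if i <ᵇ j then + 0 else f (i ∸ j)

infixl 6 _+L_ _-L_
infixl 7 _*L_

_+L_ : Laurent → Laurent → Laurent
laurent k f +L laurent l g = laurent (k ℕ.+ l) (λ i → shiftBy l f i ℤ.+ shiftBy k g i)

-L_ : Laurent → Laurent
-L laurent k f = laurent k (λ i → ℤ.- f i)

_-L_ : Laurent → Laurent → Laurent
L -L M = L +L (-L M)

_*L_ : Laurent → Laurent → Laurent
laurent k f *L laurent l g = laurent (k ℕ.+ l) (λ n → sumTo n (λ i → f i ℤ.* g (n ∸ i)))

mono : ℤ → ℕ → Laurent
mono c m = laurent 0 (λ i → if i ≡ᵇ m then c else + 0)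

zInv : Laurent
zInv = laurent 1 (λ i → if i ≡ᵇ 0 then + 1 else + 0)

zL : ℕ → Laurent
zL m = mono (+ 1) m

oneL zeroL : Laurent
oneL  = zL 0
zeroL = mono (+ 0) 0

infixr 8 _^L_
_^L_ : Laurent → ℕ → Laurent
L ^L zero  = oneL
L ^L suc n = L *L (L ^L n)

IsRoot : Laurent → Set
IsRoot u = zL 1 *L u ^L 3 +L (zL 2 -L oneL) *L u ^L 2 -L zL 3 *L u +L zL 2 ≈ zeroL

v1Prefix : Laurent
v1Prefix = zInv -L zL 1 -L zL 5 -L mono (+ 2) 7

IsV1 : Laurent → Set
IsV1 u = IsRoot u × (∀ m → m ℤ.< + 8 → coeffAt u m ≡ coeffAt v1Prefix m)

-- coefficient of z^i is a (i/2) for even i, 0 for odd i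
evenCoeff : (ℕ → ℤ) → ℕ → ℤ
evenCoeff a zero          = a 0
evenCoeff a (suc zero)    = + 0
evenCoeff a (suc (suc i)) = evenCoeff (λ n → a (suc n)) i

dCoeff : ℕ → ℤ
dCoeff zero    = + 0
dCoeff (suc n) = + d (suc n)

DGF : Laurent
DGF = laurent 0 (evenCoeff dCoeff)

{-# OPTIONS --safe #-}

-- Whether a path is admissible is decided step by step from its height and a three-state
-- mode (just climbed, or inside a descent of odd resp. even length so far). Cutting a path
-- at the first time it comes down to a lower level gives, for the generating functions a, b
-- of first passages from height 1 to height 0 ending with an odd resp. even descent,
--   a − z = z a (a − z) + z² b,    b = z a (b + z),
-- and for the generating function F of all admissible paths F = 1 + z (a + b) F.
-- Eliminating b, y = 1 − z a satisfies y³ + (z² − 1) y² − z⁴ y + z⁴ = 0, i.e. v = y / z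
-- = 1/z − a is a root of the cubic, and the equations combine to
-- (F − 1)(v (1 − z²) − z) = z² v. Any other root y′ with y′(0) = 1 satisfies (y − y′) Q = 0
-- with Q(0) = 1, hence y′ = y. Laurent series enter only as fractions p / z^s.

module Submission where

open import Defs
open import Algebra.Bundles using (CommutativeRing)
import Algebra.Construct.Pointwise
import Algebra.Properties.CommutativeSemigroup
import Algebra.Properties.Semiring.Exp
import Algebra.Solver.Ring
open import Algebra.Solver.Ring.AlmostCommutativeRing
  using (fromCommutativeRing; _-Raw-AlmostCommutative⟶_; Induced-equivalence)
open import Data.Bool using (Bool; true; false; not; _∧_; if_then_else_)
import Data.Bool.Properties as BoolP
open import Data.Empty using (⊥-elim)
open import Data.Integer as ℤ using (ℤ; +_; -[1+_])
import Data.Integer.Properties as ℤP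
import Data.Integer.Solver
open import Data.List using (List; []; _∷_; length; filterᵇ; concatMap)
open import Data.Maybe using (just; nothing)
open import Data.Nat as ℕ using (ℕ; zero; suc; _∸_; _≡ᵇ_; _<ᵇ_; z≤n; s≤s)
import Data.Nat.Properties as ℕP
open import Data.Product using (Σ; _×_; _,_)
open import Data.Sum using (inj₁; inj₂)
open import Function using (_∘_; _⇔_; mk⇔; Equivalence)
open import Level using (0ℓ)
open import Relation.Binary.Definitions using (WeaklyDecidable)
open import Relation.Binary.PropositionalEquality
import Relation.Binary.Reasoning.Setoid
open import Relation.Nullary using (yes; no)

module ℤSolver = Data.Integer.Solver.+-*-Solver
open Algebra.Properties.CommutativeSemigroup ℤP.+-commutativeSemigroup
  using () renaming (interchange to +-interchange)

sumTo-cong-≤ : ∀ n {f g : ℕ → ℤ} → (∀ i → i ℕ.≤ n → f i ≡ g i) → sumTo n f ≡ sumTo n g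
sumTo-cong-≤ zero    f≡g = f≡g 0 z≤n
sumTo-cong-≤ (suc n) f≡g =
  cong₂ ℤ._+_ (sumTo-cong-≤ n (λ i i≤n → f≡g i (ℕP.m≤n⇒m≤1+n i≤n)))
              (f≡g (suc n) ℕP.≤-refl)

sumTo-cong : ∀ n {f g : ℕ → ℤ} → (∀ i → f i ≡ g i) → sumTo n f ≡ sumTo n g
sumTo-cong n f≡g = sumTo-cong-≤ n (λ i _ → f≡g i)

sumTo-zero : ∀ n {f : ℕ → ℤ} → (∀ i → i ℕ.≤ n → f i ≡ + 0) → sumTo n f ≡ + 0
sumTo-zero zero    f≡0 = f≡0 0 z≤n
sumTo-zero (suc n) f≡0 =
  cong₂ ℤ._+_ (sumTo-zero n (λ i i≤n → f≡0 i (ℕP.m≤n⇒m≤1+n i≤n))) (f≡0 (suc n) ℕP.≤-refl)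

sumTo-+ : ∀ n (f g : ℕ → ℤ) → sumTo n (λ i → f i ℤ.+ g i) ≡ sumTo n f ℤ.+ sumTo n g
sumTo-+ zero    f g = refl
sumTo-+ (suc n) f g = begin
  sumTo n (λ i → f i ℤ.+ g i) ℤ.+ (f (suc n) ℤ.+ g (suc n))
    ≡⟨ cong (ℤ._+ (f (suc n) ℤ.+ g (suc n))) (sumTo-+ n f g) ⟩
  (sumTo n f ℤ.+ sumTo n g) ℤ.+ (f (suc n) ℤ.+ g (suc n))
    ≡⟨ +-interchange (sumTo n f) _ _ _ ⟩
  (sumTo n f ℤ.+ f (suc n)) ℤ.+ (sumTo n g ℤ.+ g (suc n)) ∎
  where open ≡-Reasoning

sumTo-*ˡ : ∀ n c (f : ℕ → ℤ) → c ℤ.* sumTo n f ≡ sumTo n (λ i → c ℤ.* f i)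
sumTo-*ˡ zero    c f = refl
sumTo-*ˡ (suc n) c f =
  trans (ℤP.*-distribˡ-+ c (sumTo n f) (f (suc n))) (cong (ℤ._+ (c ℤ.* f (suc n))) (sumTo-*ˡ n c f))

sumTo-unfoldˡ : ∀ n (f : ℕ → ℤ) → sumTo (suc n) f ≡ f 0 ℤ.+ sumTo n (f ∘ suc)
sumTo-unfoldˡ zero    f = refl
sumTo-unfoldˡ (suc n) f =
  trans (cong (ℤ._+ f (suc (suc n))) (sumTo-unfoldˡ n f)) (ℤP.+-assoc (f 0) _ _)

sumTo-reverse : ∀ n (f : ℕ → ℤ) → sumTo n f ≡ sumTo n (λ i → f (n ∸ i))
sumTo-reverse zero    f = refl
sumTo-reverse (suc n) f = begin
  sumTo n f ℤ.+ f (suc n)                     ≡⟨ ℤP.+-comm (sumTo n f) _ ⟩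
  f (suc n) ℤ.+ sumTo n f                     ≡⟨ cong (λ s → f (suc n) ℤ.+ s) (sumTo-reverse n f) ⟩
  f (suc n) ℤ.+ sumTo n (λ i → f (n ∸ i))     ≡⟨ sumTo-unfoldˡ n (λ i → f (suc n ∸ i)) ⟨
  sumTo (suc n) (λ i → f (suc n ∸ i))         ∎
  where open ≡-Reasoning

-- Formal power series over ℤ

Series : Set
Series = ℕ → ℤ

infix  4 _≐_
infixl 6 _⊕_
infixl 7 _⊛_
infix  8 ⊝_

_≐_ : Series → Series → Set
p ≐ q = ∀ n → p n ≡ q n

_⊕_ : Series → Series → Series
(p ⊕ q) n = p n ℤ.+ q n

⊝_ : Series → Series
(⊝ p) n = ℤ.- p n

_⊛_ : Series → Series → Series
(p ⊛ q) n = sumTo n (λ i → p i ℤ.* q (n ∸ i))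

𝟘 𝟙 𝕏 : Series
𝟘 _ = + 0
𝟙 n = if n ≡ᵇ 0 then + 1 else + 0
𝕏 n = if n ≡ᵇ 1 then + 1 else + 0

tail : Series → Series
tail p n = p (suc n)

⊛-suc : ∀ p q n → (p ⊛ q) (suc n) ≡ p 0 ℤ.* q (suc n) ℤ.+ (tail p ⊛ q) n
⊛-suc p q n = sumTo-unfoldˡ n (λ i → p i ℤ.* q (suc n ∸ i))

⊛-cong : ∀ {p p′ q q′} → p ≐ p′ → q ≐ q′ → p ⊛ q ≐ p′ ⊛ q′
⊛-cong p≐p′ q≐q′ n = sumTo-cong n (λ i → cong₂ ℤ._*_ (p≐p′ i) (q≐q′ (n ∸ i)))

⊛-comm : ∀ p q → p ⊛ q ≐ q ⊛ p
⊛-comm p q n = begin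
  sumTo n (λ i → p i ℤ.* q (n ∸ i))                  ≡⟨ sumTo-reverse n _ ⟩
  sumTo n (λ i → p (n ∸ i) ℤ.* q (n ∸ (n ∸ i)))      ≡⟨ sumTo-cong-≤ n swap ⟩
  sumTo n (λ i → q i ℤ.* p (n ∸ i))                  ∎
  where
  open ≡-Reasoning
  swap : ∀ i → i ℕ.≤ n → p (n ∸ i) ℤ.* q (n ∸ (n ∸ i)) ≡ q i ℤ.* p (n ∸ i)
  swap i i≤n rewrite ℕP.m∸[m∸n]≡n i≤n = ℤP.*-comm (p (n ∸ i)) (q i)

⊛-distribˡ : ∀ p q r → p ⊛ (q ⊕ r) ≐ p ⊛ q ⊕ p ⊛ r
⊛-distribˡ p q r n =
  trans (sumTo-cong n (λ i → ℤP.*-distribˡ-+ (p i) (q (n ∸ i)) (r (n ∸ i)))) (sumTo-+ n _ _)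

⊛-distribʳ : ∀ p q r → (q ⊕ r) ⊛ p ≐ q ⊛ p ⊕ r ⊛ p
⊛-distribʳ p q r n =
  trans (sumTo-cong n (λ i → ℤP.*-distribʳ-+ (p (n ∸ i)) (q i) (r i))) (sumTo-+ n _ _)

⊛-zeroˡ : ∀ p → 𝟘 ⊛ p ≐ 𝟘
⊛-zeroˡ p n = sumTo-zero n (λ _ _ → refl)

⊛-identityˡ : ∀ p → 𝟙 ⊛ p ≐ p
⊛-identityˡ p zero    = ℤP.*-identityˡ (p 0)
⊛-identityˡ p (suc n) = begin
  (𝟙 ⊛ p) (suc n)                        ≡⟨ ⊛-suc 𝟙 p n ⟩
  + 1 ℤ.* p (suc n) ℤ.+ (𝟘 ⊛ p) n
                                         ≡⟨ cong₂ ℤ._+_ (ℤP.*-identityˡ (p (suc n))) (⊛-zeroˡ p n) ⟩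
  p (suc n) ℤ.+ + 0                      ≡⟨ ℤP.+-identityʳ _ ⟩
  p (suc n)                              ∎
  where open ≡-Reasoning

⊛-identityʳ : ∀ p → p ⊛ 𝟙 ≐ p
⊛-identityʳ p n = trans (⊛-comm p 𝟙 n) (⊛-identityˡ p n)

⊛-assoc : ∀ p q r → (p ⊛ q) ⊛ r ≐ p ⊛ (q ⊛ r)
⊛-assoc p q r zero    = ℤP.*-assoc (p 0) (q 0) (r 0)
⊛-assoc p q r (suc n) = begin
  ((p ⊛ q) ⊛ r) (suc n)
    ≡⟨ ⊛-suc (p ⊛ q) r n ⟩
  p 0 ℤ.* q 0 ℤ.* r (suc n) ℤ.+ (tail (p ⊛ q) ⊛ r) n
    ≡⟨ cong (λ s → p 0 ℤ.* q 0 ℤ.* r (suc n) ℤ.+ s) (tail-⊛-assoc n) ⟩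
  p 0 ℤ.* q 0 ℤ.* r (suc n) ℤ.+ (p 0 ℤ.* (tail q ⊛ r) n ℤ.+ (tail p ⊛ (q ⊛ r)) n)
    ≡⟨ solve 5 (λ a b c d e → (a :* b) :* c :+ (a :* d :+ e) := a :* (b :* c :+ d) :+ e) refl
             (p 0) (q 0) (r (suc n)) ((tail q ⊛ r) n) ((tail p ⊛ (q ⊛ r)) n) ⟩
  p 0 ℤ.* (q 0 ℤ.* r (suc n) ℤ.+ (tail q ⊛ r) n) ℤ.+ (tail p ⊛ (q ⊛ r)) n
    ≡⟨ cong (λ s → p 0 ℤ.* s ℤ.+ (tail p ⊛ (q ⊛ r)) n) (⊛-suc q r n) ⟨
  p 0 ℤ.* (q ⊛ r) (suc n) ℤ.+ (tail p ⊛ (q ⊛ r)) n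
    ≡⟨ ⊛-suc p (q ⊛ r) n ⟨
  (p ⊛ (q ⊛ r)) (suc n) ∎
  where
  open ≡-Reasoning
  open ℤSolver
  tail-⊛-assoc : ∀ n → (tail (p ⊛ q) ⊛ r) n ≡ p 0 ℤ.* (tail q ⊛ r) n ℤ.+ (tail p ⊛ (q ⊛ r)) n
  tail-⊛-assoc n = begin
    (tail (p ⊛ q) ⊛ r) n
      ≡⟨ sumTo-cong n (λ i → cong (ℤ._* r (n ∸ i)) (⊛-suc p q i)) ⟩
    sumTo n (λ i → (p 0 ℤ.* q (suc i) ℤ.+ (tail p ⊛ q) i) ℤ.* r (n ∸ i))
      ≡⟨ sumTo-cong n (λ i → ℤP.*-distribʳ-+ (r (n ∸ i)) (p 0 ℤ.* q (suc i)) ((tail p ⊛ q) i)) ⟩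
    sumTo n (λ i → p 0 ℤ.* q (suc i) ℤ.* r (n ∸ i) ℤ.+ (tail p ⊛ q) i ℤ.* r (n ∸ i))
      ≡⟨ sumTo-+ n _ _ ⟩
    sumTo n (λ i → p 0 ℤ.* q (suc i) ℤ.* r (n ∸ i)) ℤ.+ ((tail p ⊛ q) ⊛ r) n
      ≡⟨ cong₂ ℤ._+_ (trans (sumTo-cong n (λ i → ℤP.*-assoc (p 0) _ _)) (sym (sumTo-*ˡ n (p 0) _)))
                     (⊛-assoc (tail p) q r n) ⟩
    p 0 ℤ.* (tail q ⊛ r) n ℤ.+ (tail p ⊛ (q ⊛ r)) n ∎

series-ring : CommutativeRing 0ℓ 0ℓ
series-ring = record
  { Carrier = Series ; _≈_ = _≐_ ; _+_ = _⊕_ ; _*_ = _⊛_ ; -_ = ⊝_ ; 0# = 𝟘 ; 1# = 𝟙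
  ; isCommutativeRing = record
    { isRing = record
      { +-isAbelianGroup = Algebra.Construct.Pointwise.isAbelianGroup ℕ ℤP.+-0-isAbelianGroup
      ; *-cong           = ⊛-cong
      ; *-assoc          = ⊛-assoc
      ; *-identity       = ⊛-identityˡ , ⊛-identityʳ
      ; distrib          = ⊛-distribˡ , ⊛-distribʳ
      }
    ; *-comm = ⊛-comm
    }
  }

open CommutativeRing series-ring
  using (+-cong; +-congˡ; +-congʳ; *-congˡ; *-congʳ; zeroʳ; +-identityˡ; +-identityʳ)
  renaming (sym to ≐-sym; trans to ≐-trans)
open Algebra.Properties.Semiring.Exp (CommutativeRing.semiring series-ring)
  using (_^_; ^-homo-*)
open Algebra.Properties.CommutativeSemigroup (CommutativeRing.*-commutativeSemigroup series-ring)
  using () renaming (interchange to ⊛-interchange)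
module ≐-Reasoning = Relation.Binary.Reasoning.Setoid (CommutativeRing.setoid series-ring)

constant : ℤ → Series
constant c n = if n ≡ᵇ 0 then c else + 0

constant-* : ∀ c d → constant (c ℤ.* d) ≐ constant c ⊛ constant d
constant-* c d zero    = refl
constant-* c d (suc n) = sym (begin
  (constant c ⊛ constant d) (suc n)        ≡⟨ ⊛-suc (constant c) (constant d) n ⟩
  c ℤ.* + 0 ℤ.+ (𝟘 ⊛ constant d) n
                                           ≡⟨ cong₂ ℤ._+_ (ℤP.*-zeroʳ c) (⊛-zeroˡ (constant d) n) ⟩
  + 0                                      ∎)
  where open ≡-Reasoning

constant-homomorphism :
  CommutativeRing.rawRing ℤP.+-*-commutativeRing -Raw-AlmostCommutative⟶ fromCommutativeRing series-ring
constant-homomorphism = record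
  { ⟦_⟧    = constant
  ; +-homo = λ c d → λ { zero → refl ; (suc n) → refl }
  ; *-homo = constant-*
  ; -‿homo = λ c → λ { zero → refl ; (suc n) → refl }
  ; 0-homo = λ { zero → refl ; (suc n) → refl }
  ; 1-homo = λ { zero → refl ; (suc n) → refl }
  }

constant-≟ : WeaklyDecidable (Induced-equivalence constant-homomorphism)
constant-≟ c d with c ℤ.≟ d
... | yes refl = just (λ _ → refl)
... | no _     = nothing

module SeriesSolver = Algebra.Solver.Ring
  (CommutativeRing.rawRing ℤP.+-*-commutativeRing) (fromCommutativeRing series-ring) constant-homomorphism
  constant-≟

𝕏⊛-suc : ∀ p n → (𝕏 ⊛ p) (suc n) ≡ p n
𝕏⊛-suc p n = begin
  (𝕏 ⊛ p) (suc n)                   ≡⟨ ⊛-suc 𝕏 p n ⟩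
  + 0 ℤ.+ (𝟙 ⊛ p) n                 ≡⟨ ℤP.+-identityˡ _ ⟩
  (𝟙 ⊛ p) n                         ≡⟨ ⊛-identityˡ p n ⟩
  p n                               ∎
  where open ≡-Reasoning

≐-𝕏⊛ : ∀ {s p} → s 0 ≡ + 0 → (∀ n → s (suc n) ≡ p n) → s ≐ 𝕏 ⊛ p
≐-𝕏⊛ s₀≡0 _      zero    = s₀≡0
≐-𝕏⊛ {p = p} _ sₙ₊₁≡pₙ (suc n) = trans (sₙ₊₁≡pₙ n) (sym (𝕏⊛-suc p n))

shiftBy-≐ : ∀ j p → shiftBy j p ≐ 𝕏 ^ j ⊛ p
shiftBy-≐ zero    p = ≐-sym (⊛-identityˡ p)
shiftBy-≐ (suc j) p = begin
  shiftBy (suc j) p      ≈⟨ ≐-𝕏⊛ refl (λ _ → refl) ⟩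
  𝕏 ⊛ shiftBy j p        ≈⟨ *-congˡ {𝕏} (shiftBy-≐ j p) ⟩
  𝕏 ⊛ (𝕏 ^ j ⊛ p)        ≈⟨ ⊛-assoc 𝕏 (𝕏 ^ j) p ⟨
  𝕏 ^ suc j ⊛ p          ∎
  where open ≐-Reasoning

shiftBy-+ : ∀ j p n → shiftBy j p (n ℕ.+ j) ≡ p n
shiftBy-+ zero    p n = cong p (ℕP.+-identityʳ n)
shiftBy-+ (suc j) p n rewrite ℕP.+-suc n j = shiftBy-+ j p n

shiftBy-< : ∀ j p {i} → i ℕ.< j → shiftBy j p i ≡ + 0
shiftBy-< j p {i} i<j with i <ᵇ j | ℕP.<⇒<ᵇ i<j
... | true | _ = refl

𝕏^⊛-+ : ∀ j p n → (𝕏 ^ j ⊛ p) (n ℕ.+ j) ≡ p n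
𝕏^⊛-+ j p n = trans (sym (shiftBy-≐ j p (n ℕ.+ j))) (shiftBy-+ j p n)

𝕏^⊛-cancel : ∀ j {p q} → 𝕏 ^ j ⊛ p ≐ 𝕏 ^ j ⊛ q → p ≐ q
𝕏^⊛-cancel j {p} {q} eq n = trans (sym (𝕏^⊛-+ j p n)) (trans (eq (n ℕ.+ j)) (𝕏^⊛-+ j q n))

p⊛q≐𝟘⇒p≐𝟘 : ∀ {p q} → q 0 ≢ + 0 → p ⊛ q ≐ 𝟘 → p ≐ 𝟘
p⊛q≐𝟘⇒p≐𝟘 {p} {q} q₀≢0 p⊛q≐𝟘 n = vanish n n ℕP.≤-refl
  where
  cancel-q₀ : ∀ n → p n ℤ.* q 0 ≡ + 0 → p n ≡ + 0
  cancel-q₀ n eq with ℤP.i*j≡0⇒i≡0∨j≡0 (p n) eq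
  ... | inj₁ pₙ≡0 = pₙ≡0
  ... | inj₂ q₀≡0 = ⊥-elim (q₀≢0 q₀≡0)
  vanish : ∀ n i → i ℕ.≤ n → p i ≡ + 0
  vanish zero    .zero z≤n = cancel-q₀ 0 (p⊛q≐𝟘 0)
  vanish (suc n) i     i≤1+n with ℕP.m≤n⇒m<n∨m≡n i≤1+n
  ... | inj₁ i<1+n = vanish n i (ℕP.≤-pred i<1+n)
  ... | inj₂ refl  = cancel-q₀ (suc n) (begin
    p (suc n) ℤ.* q 0
      ≡⟨ cong (λ k → p (suc n) ℤ.* q k) (ℕP.n∸n≡0 n) ⟨
    p (suc n) ℤ.* q (n ∸ n)
      ≡⟨ ℤP.+-identityˡ _ ⟨
    + 0 ℤ.+ p (suc n) ℤ.* q (n ∸ n)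
      ≡⟨ cong (ℤ._+ p (suc n) ℤ.* q (n ∸ n)) lower-terms ⟨
    sumTo n (λ j → p j ℤ.* q (suc n ∸ j)) ℤ.+ p (suc n) ℤ.* q (n ∸ n)
      ≡⟨ p⊛q≐𝟘 (suc n) ⟩
    + 0 ∎)
    where
    open ≡-Reasoning
    lower-terms : sumTo n (λ j → p j ℤ.* q (suc n ∸ j)) ≡ + 0
    lower-terms = sumTo-zero n (λ j j≤n → cong (ℤ._* q (suc n ∸ j)) (vanish n j j≤n))

monomial-≐ : ∀ m → (λ i → if i ≡ᵇ m then + 1 else + 0) ≐ 𝕏 ^ m
monomial-≐ zero    = λ { zero → refl ; (suc _) → refl }
monomial-≐ (suc m) = ≐-𝕏⊛ refl (monomial-≐ m)

-- Laurent series as fractions of power series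

coeffℤ : Series → ℤ → ℤ
coeffℤ p (+ n)    = p n
coeffℤ p -[1+ _ ] = + 0

coeffℤ-cong : ∀ {p q} → p ≐ q → ∀ x → coeffℤ p x ≡ coeffℤ q x
coeffℤ-cong p≐q (+ n)    = p≐q n
coeffℤ-cong p≐q -[1+ _ ] = refl

coeffℤ-⊕ : ∀ p q x → coeffℤ (p ⊕ q) x ≡ coeffℤ p x ℤ.+ coeffℤ q x
coeffℤ-⊕ p q (+ n)    = refl
coeffℤ-⊕ p q -[1+ _ ] = refl

coeffℤ-⊝ : ∀ p x → coeffℤ (⊝ p) x ≡ ℤ.- coeffℤ p x
coeffℤ-⊝ p (+ n)    = refl
coeffℤ-⊝ p -[1+ _ ] = refl

coeffℤ-shiftBy : ∀ j p x → coeffℤ (shiftBy j p) (x ℤ.+ + j) ≡ coeffℤ p x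
coeffℤ-shiftBy j p (+ n)    = shiftBy-+ j p n
coeffℤ-shiftBy j p -[1+ n ] with -[1+ n ] ℤ.+ + j in eq
... | -[1+ _ ] = refl
... | + i      = shiftBy-< j p (ℤP.drop‿+<+ (subst (ℤ._< + j) eq (ℤP.+-monoˡ-< (+ j) ℤ.-<+)))

coeffℤ-𝕏^⊛ : ∀ j p x → coeffℤ (𝕏 ^ j ⊛ p) (x ℤ.+ + j) ≡ coeffℤ p x
coeffℤ-𝕏^⊛ j p x = trans (sym (coeffℤ-cong (shiftBy-≐ j p) (x ℤ.+ + j))) (coeffℤ-shiftBy j p x)

infix 4 _≅_/z^_
_≅_/z^_ : Laurent → Series → ℕ → Set
L ≅ p /z^ s = ∀ m → coeffAt L m ≡ coeffℤ p (m ℤ.+ + s)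

≅-canonical : ∀ L → L ≅ coeff L /z^ ord L
≅-canonical (laurent k f) m with m ℤ.+ + k
... | + _      = refl
... | -[1+ _ ] = refl

≅-≐ : ∀ {L p q s} → L ≅ p /z^ s → p ≐ q → L ≅ q /z^ s
≅-≐ {s = s} L≅p p≐q m = trans (L≅p m) (coeffℤ-cong p≐q (m ℤ.+ + s))

≅-resp-≈ : ∀ {L M p s} → L ≈ M → M ≅ p /z^ s → L ≅ p /z^ s
≅-resp-≈ L≈M M≅p m = trans (L≈M m) (M≅p m)

≅-≈ : ∀ {L M p s} → L ≅ p /z^ s → M ≅ p /z^ s → L ≈ M
≅-≈ L≅p M≅p m = trans (L≅p m) (sym (M≅p m))

≅-injective : ∀ {L p q s} → L ≅ p /z^ s → L ≅ q /z^ s → p ≐ q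
≅-injective {L} {p} {q} {s} L≅p L≅q n = begin
  coeffℤ p (+ n)                  ≡⟨ cong (coeffℤ p) n-s+s≡n ⟨
  coeffℤ p (+ n ℤ.- + s ℤ.+ + s)  ≡⟨ trans (sym (L≅p (+ n ℤ.- + s))) (L≅q (+ n ℤ.- + s)) ⟩
  coeffℤ q (+ n ℤ.- + s ℤ.+ + s)  ≡⟨ cong (coeffℤ q) n-s+s≡n ⟩
  coeffℤ q (+ n)                  ∎
  where
  open ≡-Reasoning
  n-s+s≡n : + n ℤ.- + s ℤ.+ + s ≡ + n
  n-s+s≡n = ℤSolver.solve 2 (λ n s → n :- s :+ s := n) refl (+ n) (+ s)
    where open ℤSolver

≅-raise : ∀ {L p s} t → L ≅ p /z^ s → L ≅ 𝕏 ^ t ⊛ p /z^ (s ℕ.+ t)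
≅-raise {p = p} {s} t L≅p m = begin
  coeffAt _ m                               ≡⟨ L≅p m ⟩
  coeffℤ p (m ℤ.+ + s)                      ≡⟨ coeffℤ-𝕏^⊛ t p (m ℤ.+ + s) ⟨
  coeffℤ (𝕏 ^ t ⊛ p) (m ℤ.+ + s ℤ.+ + t)    ≡⟨ cong (coeffℤ (𝕏 ^ t ⊛ p)) (ℤP.+-assoc m _ _) ⟩
  coeffℤ (𝕏 ^ t ⊛ p) (m ℤ.+ + (s ℕ.+ t))    ∎
  where open ≡-Reasoning

≅-lower : ∀ {L p s} t → L ≅ 𝕏 ^ t ⊛ p /z^ (s ℕ.+ t) → L ≅ p /z^ s
≅-lower {p = p} {s} t L≅p m = begin
  coeffAt _ m                               ≡⟨ L≅p m ⟩
  coeffℤ (𝕏 ^ t ⊛ p) (m ℤ.+ + (s ℕ.+ t))    ≡⟨ cong (coeffℤ (𝕏 ^ t ⊛ p)) (ℤP.+-assoc m _ _) ⟨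
  coeffℤ (𝕏 ^ t ⊛ p) (m ℤ.+ + s ℤ.+ + t)    ≡⟨ coeffℤ-𝕏^⊛ t p (m ℤ.+ + s) ⟩
  coeffℤ p (m ℤ.+ + s)                      ∎
  where open ≡-Reasoning

≅-cross : ∀ {L p q s t} → L ≅ p /z^ s → L ≅ q /z^ t → 𝕏 ^ t ⊛ p ≐ 𝕏 ^ s ⊛ q
≅-cross {L} {q = q} {s} {t} L≅p L≅q =
  ≅-injective (≅-raise t L≅p) (subst (L ≅ 𝕏 ^ s ⊛ q /z^_) (ℕP.+-comm t s) (≅-raise s L≅q))

≅-rescale : ∀ {L p q s t} → L ≅ p /z^ s → 𝕏 ^ t ⊛ p ≐ 𝕏 ^ s ⊛ q → L ≅ q /z^ t
≅-rescale {L} {q = q} {s} {t} L≅p eq =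
  ≅-lower s (subst (L ≅ 𝕏 ^ s ⊛ q /z^_) (ℕP.+-comm s t) (≅-≐ (≅-raise t L≅p) eq))

≅-zL : ∀ m → zL m ≅ 𝕏 ^ m /z^ 0
≅-zL m = ≅-≐ (≅-canonical (zL m)) (monomial-≐ m)

≅-zeroL : zeroL ≅ 𝟘 /z^ 0
≅-zeroL = ≅-≐ (≅-canonical zeroL) (λ { zero → refl ; (suc _) → refl })

coeffAt-+L : ∀ L M m → coeffAt (L +L M) m ≡ coeffAt L m ℤ.+ coeffAt M m
coeffAt-+L L@(laurent k f) M@(laurent l g) m = begin
  coeffAt (L +L M) m
    ≡⟨ ≅-≐ (≅-canonical (L +L M)) (+-cong (shiftBy-≐ l f) (shiftBy-≐ k g)) m ⟩
  coeffℤ (𝕏 ^ l ⊛ f ⊕ 𝕏 ^ k ⊛ g) (m ℤ.+ + (k ℕ.+ l))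
    ≡⟨ coeffℤ-⊕ (𝕏 ^ l ⊛ f) (𝕏 ^ k ⊛ g) (m ℤ.+ + (k ℕ.+ l)) ⟩
  coeffℤ (𝕏 ^ l ⊛ f) (m ℤ.+ + (k ℕ.+ l)) ℤ.+ coeffℤ (𝕏 ^ k ⊛ g) (m ℤ.+ + (k ℕ.+ l))
    ≡⟨ cong₂ ℤ._+_ (≅-raise l (≅-canonical L) m)
                   (subst (M ≅ 𝕏 ^ k ⊛ g /z^_) (ℕP.+-comm l k) (≅-raise k (≅-canonical M)) m) ⟨
  coeffAt L m ℤ.+ coeffAt M m ∎
  where open ≡-Reasoning

≅-+L : ∀ {L M p q s} → L ≅ p /z^ s → M ≅ q /z^ s → L +L M ≅ p ⊕ q /z^ s
≅-+L {L} {M} {p} {q} {s} L≅p M≅q m = begin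
  coeffAt (L +L M) m                           ≡⟨ coeffAt-+L L M m ⟩
  coeffAt L m ℤ.+ coeffAt M m                  ≡⟨ cong₂ ℤ._+_ (L≅p m) (M≅q m) ⟩
  coeffℤ p (m ℤ.+ + s) ℤ.+ coeffℤ q (m ℤ.+ + s) ≡⟨ coeffℤ-⊕ p q (m ℤ.+ + s) ⟨
  coeffℤ (p ⊕ q) (m ℤ.+ + s)                   ∎
  where open ≡-Reasoning

≅--L : ∀ {L p s} → L ≅ p /z^ s → -L L ≅ ⊝ p /z^ s
≅--L {L@(laurent k f)} {p} {s} L≅p m = begin
  coeffAt (-L L) m                ≡⟨ ≅-canonical (-L L) m ⟩
  coeffℤ (⊝ f) (m ℤ.+ + k)        ≡⟨ coeffℤ-⊝ f (m ℤ.+ + k) ⟩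
  ℤ.- coeffℤ f (m ℤ.+ + k)        ≡⟨ cong ℤ.-_ (trans (sym (≅-canonical L m)) (L≅p m)) ⟩
  ℤ.- coeffℤ p (m ℤ.+ + s)        ≡⟨ coeffℤ-⊝ p (m ℤ.+ + s) ⟨
  coeffℤ (⊝ p) (m ℤ.+ + s)        ∎
  where open ≡-Reasoning

≅-*L : ∀ {L M p q s t} → L ≅ p /z^ s → M ≅ q /z^ t → L *L M ≅ p ⊛ q /z^ (s ℕ.+ t)
≅-*L {L@(laurent k f)} {M@(laurent l g)} {p} {q} {s} {t} L≅p M≅q =
  ≅-rescale (≅-canonical (L *L M)) (begin
    𝕏 ^ (s ℕ.+ t) ⊛ (f ⊛ g)          ≈⟨ *-congʳ {f ⊛ g} (^-homo-* 𝕏 s t) ⟩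
    (𝕏 ^ s ⊛ 𝕏 ^ t) ⊛ (f ⊛ g)        ≈⟨ ⊛-interchange (𝕏 ^ s) (𝕏 ^ t) f g ⟩
    (𝕏 ^ s ⊛ f) ⊛ (𝕏 ^ t ⊛ g)        ≈⟨ ⊛-cong (≅-cross (≅-canonical L) L≅p)
                                               (≅-cross (≅-canonical M) M≅q) ⟩
    (𝕏 ^ k ⊛ p) ⊛ (𝕏 ^ l ⊛ q)        ≈⟨ ⊛-interchange (𝕏 ^ k) p (𝕏 ^ l) q ⟩
    (𝕏 ^ k ⊛ 𝕏 ^ l) ⊛ (p ⊛ q)        ≈⟨ *-congʳ {p ⊛ q} (^-homo-* 𝕏 k l) ⟨
    𝕏 ^ (k ℕ.+ l) ⊛ (p ⊛ q)          ∎)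
  where open ≐-Reasoning

≅-^L : ∀ {L p s} → L ≅ p /z^ s → ∀ n → L ^L n ≅ p ^ n /z^ (n ℕ.* s)
≅-^L L≅p zero    = ≅-zL 0
≅-^L L≅p (suc n) = ≅-*L L≅p (≅-^L L≅p n)

≅-from-vanishing : ∀ {L} s → (∀ m → m ℤ.+ + s ℤ.< + 0 → coeffAt L m ≡ + 0) →
                   L ≅ (λ n → coeffAt L (+ n ℤ.- + s)) /z^ s
≅-from-vanishing {L} s vanish m with m ℤ.+ + s in eq
... | + n      = cong (coeffAt L) (trans (ℤSolver.solve 2 (λ m s → m := m :+ s :- s) refl m (+ s))
                                         (cong (ℤ._- + s) eq))
  where open ℤSolver
... | -[1+ _ ] = vanish m (subst (ℤ._< + 0) (sym eq) ℤ.-<+)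

-- Counting admissible paths

count : (List Step → Bool) → ℕ → ℕ
count P k = length (filterᵇ P (words k))

count-cong : ∀ {P Q} → (∀ w → P w ≡ Q w) → ∀ k → count P k ≡ count Q k
count-cong {P} {Q} P≡Q k = go (words k)
  where
  go : ∀ ws → length (filterᵇ P ws) ≡ length (filterᵇ Q ws)
  go []       = refl
  go (w ∷ ws) rewrite P≡Q w with Q w
  ... | true  = cong suc (go ws)
  ... | false = go ws

count-false : ∀ k → count (λ _ → false) k ≡ 0
count-false k = go (words k)
  where
  go : ∀ ws → length (filterᵇ (λ _ → false) ws) ≡ 0
  go []       = refl
  go (_ ∷ ws) = go ws

count-∧ : ∀ c P k → count (λ w → c ∧ P w) k ≡ (if c then count P k else 0)
count-∧ true  P k = refl
count-∧ false P k = count-false k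

count-suc : ∀ P k → count P (suc k) ≡ count (P ∘ (U ∷_)) k ℕ.+ count (P ∘ (D ∷_)) k
count-suc P k = go (words k)
  where
  go : ∀ ws → length (filterᵇ P (concatMap (λ w → (U ∷ w) ∷ (D ∷ w) ∷ []) ws))
              ≡ length (filterᵇ (P ∘ (U ∷_)) ws) ℕ.+ length (filterᵇ (P ∘ (D ∷_)) ws)
  go []       = refl
  go (w ∷ ws) with P (U ∷ w)
  ... | true  with P (D ∷ w)
  ...   | true  = cong suc (trans (cong suc (go ws)) (sym (ℕP.+-suc _ _)))
  ...   | false = cong suc (go ws)
  go (w ∷ ws) | false with P (D ∷ w)
  ...   | true  = trans (cong suc (go ws)) (sym (ℕP.+-suc _ _))
  ...   | false = go ws

-- The state of the automaton reading a path: just after an up-step (or at the start), or inside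
-- a descent whose length so far is odd or even. An up-step may only follow an odd descent,
-- except at height 0, where the mode is forgotten.
data Mode : Set where
  climbing   : Mode
  descending : (odd : Bool) → Mode

upAllowed : Mode → Bool
upAllowed climbing         = true
upAllowed (descending odd) = odd

parityAfterDown : Mode → Bool
parityAfterDown climbing         = true
parityAfterDown (descending odd) = not odd

admissible : ℕ → Mode → ℕ → ℕ
admissible h       m zero    = if h ≡ᵇ 0 then 1 else 0
admissible zero    m (suc k) = admissible 1 climbing k
admissible (suc h) m (suc k) =
  (if upAllowed m then admissible (2 ℕ.+ h) climbing k else 0)
  ℕ.+ admissible h (descending (parityAfterDown m)) k

admissibleFrom : ℕ → List Step → Bool
admissibleFrom h w = dyckFrom h w ∧ goodFrom h w

admissibleInRun : ℕ → ℕ → List Step → Bool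
admissibleInRun h ℓ w = dyckFrom h w ∧ inRun h ℓ w

oddᵇ-suc : ∀ ℓ → oddᵇ (suc ℓ) ≡ not (oddᵇ ℓ)
oddᵇ-suc zero          = refl
oddᵇ-suc (suc zero)    = refl
oddᵇ-suc (suc (suc ℓ)) = oddᵇ-suc ℓ

∧-left-comm : ∀ x y z → x ∧ (y ∧ z) ≡ y ∧ (x ∧ z)
∧-left-comm true  y z = refl
∧-left-comm false y z = sym (BoolP.∧-zeroʳ y)

mutual
  count-admissibleFrom : ∀ h k → count (admissibleFrom h) k ≡ admissible h climbing k
  count-admissibleFrom zero    zero    = refl
  count-admissibleFrom (suc h) zero    = refl
  count-admissibleFrom zero    (suc k) = begin
    count (admissibleFrom 0) (suc k)                       ≡⟨ count-suc (admissibleFrom 0) k ⟩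
    count (admissibleFrom 1) k ℕ.+ count (λ _ → false) k
      ≡⟨ cong₂ ℕ._+_ (count-admissibleFrom 1 k) (count-false k) ⟩
    admissible 1 climbing k ℕ.+ 0                          ≡⟨ ℕP.+-identityʳ _ ⟩
    admissible 1 climbing k                                ∎
    where open ≡-Reasoning
  count-admissibleFrom (suc h) (suc k) =
    trans (count-suc (admissibleFrom (suc h)) k)
          (cong₂ ℕ._+_ (count-admissibleFrom (2 ℕ.+ h) k) (count-admissibleInRun h 1 k))

  count-admissibleInRun : ∀ h ℓ k → count (admissibleInRun h ℓ) k ≡ admissible h (descending (oddᵇ ℓ)) k
  count-admissibleInRun zero    ℓ zero    = refl
  count-admissibleInRun (suc h) ℓ zero    = refl
  count-admissibleInRun zero    ℓ (suc k) = begin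
    count (admissibleInRun 0 ℓ) (suc k)                    ≡⟨ count-suc (admissibleInRun 0 ℓ) k ⟩
    count (admissibleFrom 1) k ℕ.+ count (λ _ → false) k   ≡⟨ count-suc (admissibleFrom 0) k ⟨
    count (admissibleFrom 0) (suc k)                       ≡⟨ count-admissibleFrom 0 (suc k) ⟩
    admissible 0 climbing (suc k)                          ∎
    where open ≡-Reasoning
  count-admissibleInRun (suc h) ℓ (suc k) = begin
    count (admissibleInRun (suc h) ℓ) (suc k)
      ≡⟨ count-suc (admissibleInRun (suc h) ℓ) k ⟩
    count (λ w → dyckFrom (2 ℕ.+ h) w ∧ (oddᵇ ℓ ∧ goodFrom (2 ℕ.+ h) w)) k
      ℕ.+ count (admissibleInRun h (suc ℓ)) k
      ≡⟨ cong (ℕ._+ count (admissibleInRun h (suc ℓ)) k)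
              (trans (count-cong (λ w → ∧-left-comm (dyckFrom (2 ℕ.+ h) w) (oddᵇ ℓ) _) k)
                     (count-∧ (oddᵇ ℓ) (admissibleFrom (2 ℕ.+ h)) k)) ⟩
    (if oddᵇ ℓ then count (admissibleFrom (2 ℕ.+ h)) k else 0) ℕ.+ count (admissibleInRun h (suc ℓ)) k
      ≡⟨ cong₂ (λ c r → (if oddᵇ ℓ then c else 0) ℕ.+ r)
               (count-admissibleFrom (2 ℕ.+ h) k)
               (trans (count-admissibleInRun h (suc ℓ) k)
                      (cong (λ o → admissible h (descending o) k) (oddᵇ-suc ℓ))) ⟩
    admissible (suc h) (descending (oddᵇ ℓ)) (suc k) ∎
    where open ≡-Reasoning

d≡admissible : ∀ n → d n ≡ admissible 0 climbing (n ℕ.+ n)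
d≡admissible n = count-admissibleFrom 0 (n ℕ.+ n)

admissible-odd : ∀ h m k → oddᵇ (h ℕ.+ k) ≡ true → admissible h m k ≡ 0
admissible-odd zero    m zero    ()
admissible-odd (suc h) m zero    _   = refl
admissible-odd zero    m (suc k) odd = admissible-odd 1 climbing k odd
admissible-odd (suc h) m (suc k) odd rewrite ℕP.+-suc h k =
  cong₂ ℕ._+_ (up (upAllowed m)) (admissible-odd h (descending (parityAfterDown m)) k odd)
  where
  up : ∀ u → (if u then admissible (2 ℕ.+ h) climbing k else 0) ≡ 0
  up true  = admissible-odd (2 ℕ.+ h) climbing k odd
  up false = refl

-- First-passage decomposition

when : Bool → Series → Series
when u p n = if u then p n else + 0

infixl 7 _⊛₂_
_⊛₂_ : (Bool → Series) → (Bool → Series) → Series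
A ⊛₂ B = A true ⊛ B true ⊕ A false ⊛ B false

⊛-suc-vanishing-head : ∀ p q n → p 0 ≡ + 0 → (p ⊛ q) (suc n) ≡ (tail p ⊛ q) n
⊛-suc-vanishing-head p q n p₀≡0 = begin
  (p ⊛ q) (suc n)                         ≡⟨ ⊛-suc p q n ⟩
  p 0 ℤ.* q (suc n) ℤ.+ (tail p ⊛ q) n    ≡⟨ cong (λ c → c ℤ.* q (suc n) ℤ.+ (tail p ⊛ q) n) p₀≡0 ⟩
  + 0 ℤ.+ (tail p ⊛ q) n                  ≡⟨ ℤP.+-identityˡ _ ⟩
  (tail p ⊛ q) n                          ∎
  where open ≡-Reasoning

⊛₂-suc-vanishing-head : ∀ A B n → (∀ p → A p 0 ≡ + 0) →
                        (A ⊛₂ B) (suc n) ≡ ((tail ∘ A) ⊛₂ B) n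
⊛₂-suc-vanishing-head A B n A₀≡0 =
  cong₂ ℤ._+_ (⊛-suc-vanishing-head (A true) (B true) n (A₀≡0 true))
              (⊛-suc-vanishing-head (A false) (B false) n (A₀≡0 false))

when-⊛₂-distrib : ∀ u F G B → when u (F ⊛₂ B) ⊕ G ⊛₂ B ≐ (λ p → when u (F p) ⊕ G p) ⊛₂ B
when-⊛₂-distrib true  F G B = solve 6 (λ f₁ f₀ g₁ g₀ b₁ b₀ →
    (f₁ :* b₁ :+ f₀ :* b₀) :+ (g₁ :* b₁ :+ g₀ :* b₀)
    := (f₁ :+ g₁) :* b₁ :+ (f₀ :+ g₀) :* b₀)
  (λ _ → refl) (F true) (F false) (G true) (G false) (B true) (B false)
  where open SeriesSolver
when-⊛₂-distrib false F G B = begin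
  𝟘 ⊕ G ⊛₂ B                                  ≈⟨ +-identityˡ (G ⊛₂ B) ⟩
  G ⊛₂ B                                      ≈⟨ +-cong (*-congʳ {B true} (+-identityˡ (G true)))
                                                        (*-congʳ {B false} (+-identityˡ (G false))) ⟨
  (λ p → 𝟘 ⊕ G p) ⊛₂ B                        ∎
  where open ≐-Reasoning

-- passage r m p counts the paths that start r levels above a target level in mode m and first
-- reach it with a descent of parity p (true = odd); for r = 0 the target is already reached.
passage : ℕ → Mode → Bool → Series
passage zero    climbing           _     = 𝟘
passage zero    (descending true)  true  = 𝟙
passage zero    (descending false) false = 𝟙
passage zero    (descending _)     _     = 𝟘
passage (suc r) m p zero    = + 0
passage (suc r) m p (suc k) =
  (if upAllowed m then passage (2 ℕ.+ r) climbing p k else + 0)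
  ℤ.+ passage r (descending (parityAfterDown m)) p k

passage-arrived : ∀ q B → passage 0 (descending q) ⊛₂ B ≐ B q
passage-arrived true  B =
  ≐-trans (+-cong (⊛-identityˡ (B true)) (⊛-zeroˡ (B false))) (+-identityʳ (B true))
passage-arrived false B =
  ≐-trans (+-cong (⊛-zeroˡ (B true)) (⊛-identityˡ (B false))) (+-identityˡ (B false))

-- Every family obeying the step recurrence of the automaton factors at the first time the path
-- has come down r + 1 levels.
module FirstPassage
  (X : ℕ → Mode → Series)
  (X-start : ∀ h m → X (suc h) m 0 ≡ + 0)
  (X-step : ∀ h m k → X (suc h) m (suc k) ≡
              when (upAllowed m) (X (2 ℕ.+ h) climbing) k ℤ.+ X h (descending (parityAfterDown m)) k)
  where

  arrivals : ℕ → Bool → Series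
  arrivals h p = X h (descending p)

  decompose : ∀ r h m → X (suc r ℕ.+ h) m ≐ passage (suc r) m ⊛₂ arrivals h
  decompose r h m zero    = X-start (r ℕ.+ h) m
  decompose r h m (suc k) = begin
    X (suc r ℕ.+ h) m (suc k)
      ≡⟨ X-step (r ℕ.+ h) m k ⟩
    when u (X (2 ℕ.+ r ℕ.+ h) climbing) k ℤ.+ X (r ℕ.+ h) (descending q) k
      ≡⟨ cong₂ ℤ._+_ (cong (λ x → if u then x else + 0) (decompose (suc r) h climbing k)) (descend r) ⟩
    (when u (passage (2 ℕ.+ r) climbing ⊛₂ B) ⊕ passage r (descending q) ⊛₂ B) k
      ≡⟨ when-⊛₂-distrib u (passage (2 ℕ.+ r) climbing) (passage r (descending q)) B k ⟩
    ((tail ∘ passage (suc r) m) ⊛₂ B) k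
      ≡⟨ ⊛₂-suc-vanishing-head (passage (suc r) m) B k (λ _ → refl) ⟨
    (passage (suc r) m ⊛₂ B) (suc k) ∎
    where
    open ≡-Reasoning
    u = upAllowed m
    q = parityAfterDown m
    B = arrivals h
    descend : ∀ r → X (r ℕ.+ h) (descending q) k ≡ (passage r (descending q) ⊛₂ B) k
    descend zero    = sym (passage-arrived q B k)
    descend (suc r) = decompose r h (descending q) k

⊕-vanish : ∀ {p q} → p ≐ 𝟘 → q ≐ 𝟘 → p ⊕ q ≐ 𝟘
⊕-vanish p≐𝟘 q≐𝟘 n = cong₂ ℤ._+_ (p≐𝟘 n) (q≐𝟘 n)

⊛-vanish : ∀ c {p} → p ≐ 𝟘 → c ⊛ p ≐ 𝟘
⊛-vanish c p≐𝟘 = ≐-trans (*-congˡ {c} p≐𝟘) (zeroʳ c)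

≐⇒⊝≐𝟘 : ∀ {p q} → p ≐ q → p ⊕ ⊝ q ≐ 𝟘
≐⇒⊝≐𝟘 {p} {q} p≐q n = trans (cong (ℤ._+ ℤ.- q n) (p≐q n)) (ℤP.+-inverseʳ (q n))

⊝≐𝟘⇒≐ : ∀ {p q} → p ⊕ ⊝ q ≐ 𝟘 → p ≐ q
⊝≐𝟘⇒≐ {p} {q} p-q≐𝟘 n = begin
  p n                         ≡⟨ solve 2 (λ p q → p := (p :- q) :+ q) refl (p n) (q n) ⟩
  (p n ℤ.- q n) ℤ.+ q n       ≡⟨ cong (ℤ._+ q n) (p-q≐𝟘 n) ⟩
  + 0 ℤ.+ q n                 ≡⟨ ℤP.+-identityˡ (q n) ⟩
  q n                         ∎
  where
  open ≡-Reasoning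
  open ℤSolver

module PassageRelations (a b t t′ z : Series)
  (a≐ : a ≐ z ⊛ (t ⊕ 𝟙)) (b≐ : b ≐ z ⊛ t′)
  (t≐ : t ≐ a ⊛ (z ⊛ t) ⊕ b ⊛ z) (t′≐ : t′ ≐ a ⊛ (z ⊛ (t′ ⊕ 𝟙)))
  where
  open SeriesSolver
  open ≐-Reasoning

  passage-equationₒ : a ⊕ ⊝ z ≐ z ⊛ a ⊛ (a ⊕ ⊝ z) ⊕ z ^ 2 ⊛ b
  passage-equationₒ = begin
    a ⊕ ⊝ z                          ≈⟨ zt≐a-z ⟨
    z ⊛ t                            ≈⟨ *-congˡ {z} t≐ ⟩
    z ⊛ (a ⊛ (z ⊛ t) ⊕ b ⊛ z)        ≈⟨ solve 4 (λ a b t z → z :* (a :* (z :* t) :+ b :* z)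
                                                          := z :* a :* (z :* t) :+ z :^ 2 :* b)
                                                (λ _ → refl) a b t z ⟩
    z ⊛ a ⊛ (z ⊛ t) ⊕ z ^ 2 ⊛ b      ≈⟨ +-congʳ {z ^ 2 ⊛ b} (*-congˡ {z ⊛ a} zt≐a-z) ⟩
    z ⊛ a ⊛ (a ⊕ ⊝ z) ⊕ z ^ 2 ⊛ b    ∎
    where
    zt≐a-z : z ⊛ t ≐ a ⊕ ⊝ z
    zt≐a-z = ≐-sym (begin
      a ⊕ ⊝ z                 ≈⟨ +-congʳ {⊝ z} a≐ ⟩
      z ⊛ (t ⊕ 𝟙) ⊕ ⊝ z       ≈⟨ solve 2 (λ t z → z :* (t :+ con (+ 1)) :- z := z :* t)
                                        (λ _ → refl) t z ⟩
      z ⊛ t                   ∎)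

  passage-equationₑ : b ≐ z ⊛ a ⊛ (b ⊕ z)
  passage-equationₑ = begin
    b                                ≈⟨ b≐ ⟩
    z ⊛ t′                           ≈⟨ *-congˡ {z} t′≐ ⟩
    z ⊛ (a ⊛ (z ⊛ (t′ ⊕ 𝟙)))         ≈⟨ solve 3 (λ a t′ z → z :* (a :* (z :* (t′ :+ con (+ 1))))
                                                          := z :* a :* (z :* t′ :+ z))
                                                (λ _ → refl) a t′ z ⟩
    z ⊛ a ⊛ (z ⊛ t′ ⊕ z)             ≈⟨ *-congˡ {z ⊛ a} (+-congʳ {z} b≐) ⟨
    z ⊛ a ⊛ (b ⊕ z)                  ∎

-- z² times the cubic of the statement, evaluated at u = y / z.
cubic : Series → Series → Series
cubic z y = y ^ 3 ⊕ (z ^ 2 ⊕ ⊝ 𝟙) ⊛ y ^ 2 ⊕ ⊝ (z ^ 4 ⊛ y) ⊕ z ^ 4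

module CubicElimination (a b z : Series)
  (eqₒ : a ⊕ ⊝ z ≐ z ⊛ a ⊛ (a ⊕ ⊝ z) ⊕ z ^ 2 ⊛ b) (eqₑ : b ≐ z ⊛ a ⊛ (b ⊕ z))
  where
  open SeriesSolver
  open ≐-Reasoning

  private
    y = 𝟙 ⊕ ⊝ (z ⊛ a)
    eqₒ-vanishes = ≐⇒⊝≐𝟘 eqₒ
    eqₑ-vanishes = ≐⇒⊝≐𝟘 eqₑ

  cubic-root : cubic z y ≐ 𝟘
  cubic-root = begin
    cubic z y
      ≈⟨ solve 3 (λ a b z → let y = con (+ 1) :- z :* a in
            y :^ 3 :+ (z :^ 2 :- con (+ 1)) :* y :^ 2 :- z :^ 4 :* y :+ z :^ 4
            := :- (z :* y) :* ((a :- z) :- (z :* a :* (a :- z) :+ z :^ 2 :* b))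
               :+ :- (z :^ 3) :* (b :- z :* a :* (b :+ z)))
          (λ _ → refl) a b z ⟩
    ⊝ (z ⊛ y) ⊛ (a ⊕ ⊝ z ⊕ ⊝ (z ⊛ a ⊛ (a ⊕ ⊝ z) ⊕ z ^ 2 ⊛ b))
      ⊕ ⊝ (z ^ 3) ⊛ (b ⊕ ⊝ (z ⊛ a ⊛ (b ⊕ z)))
      ≈⟨ ⊕-vanish (⊛-vanish (⊝ (z ⊛ y)) eqₒ-vanishes) (⊛-vanish (⊝ (z ^ 3)) eqₑ-vanishes) ⟩
    𝟘 ∎

  paths-identity : ∀ {F} → F ≐ 𝟙 ⊕ z ⊛ ((a ⊕ b) ⊛ F) →
                   (F ⊕ ⊝ 𝟙) ⊛ (y ⊛ (𝟙 ⊕ ⊝ (z ^ 2)) ⊕ ⊝ (z ^ 2)) ≐ z ^ 2 ⊛ y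
  paths-identity {F} F≐ = ⊝≐𝟘⇒≐ (begin
    (F ⊕ ⊝ 𝟙) ⊛ (y ⊛ (𝟙 ⊕ ⊝ (z ^ 2)) ⊕ ⊝ (z ^ 2)) ⊕ ⊝ (z ^ 2 ⊛ y)
      ≈⟨ solve 4 (λ a b z F → let y = con (+ 1) :- z :* a ; W = y :* (con (+ 1) :- z :^ 2) :- z :^ 2 in
            (F :- con (+ 1)) :* W :- z :^ 2 :* y
            := (W :+ z :^ 2 :* y) :* (F :- (con (+ 1) :+ z :* ((a :+ b) :* F)))
               :+ (F :* z) :* (((a :- z) :- (z :* a :* (a :- z) :+ z :^ 2 :* b)) :+ (b :- z :* a :* (b :+ z))))
          (λ _ → refl) a b z F ⟩
    (W ⊕ z ^ 2 ⊛ y) ⊛ (F ⊕ ⊝ (𝟙 ⊕ z ⊛ ((a ⊕ b) ⊛ F)))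
      ⊕ (F ⊛ z) ⊛ ((a ⊕ ⊝ z ⊕ ⊝ (z ⊛ a ⊛ (a ⊕ ⊝ z) ⊕ z ^ 2 ⊛ b))
                   ⊕ (b ⊕ ⊝ (z ⊛ a ⊛ (b ⊕ z))))
      ≈⟨ ⊕-vanish (⊛-vanish (W ⊕ z ^ 2 ⊛ y) (≐⇒⊝≐𝟘 F≐))
                  (⊛-vanish (F ⊛ z) (⊕-vanish eqₒ-vanishes eqₑ-vanishes)) ⟩
    𝟘 ∎)
    where W = y ⊛ (𝟙 ⊕ ⊝ (z ^ 2)) ⊕ ⊝ (z ^ 2)

cubic-root-unique : ∀ {y₁ y₂} → cubic 𝕏 y₁ ≐ 𝟘 → cubic 𝕏 y₂ ≐ 𝟘 →
                    y₁ 0 ≡ + 1 → y₂ 0 ≡ + 1 → y₁ ≐ y₂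
cubic-root-unique {y₁} {y₂} y₁-root y₂-root y₁₀≡1 y₂₀≡1 =
  ⊝≐𝟘⇒≐ (p⊛q≐𝟘⇒p≐𝟘 {q = Q y₁ y₂} Q₀≢0 factored)
  where
  Q : Series → Series → Series
  Q u₁ u₂ = u₁ ⊛ u₁ ⊕ u₁ ⊛ u₂ ⊕ u₂ ⊛ u₂ ⊕ (𝕏 ^ 2 ⊕ ⊝ 𝟙) ⊛ (u₁ ⊕ u₂) ⊕ ⊝ (𝕏 ^ 4)
  factored : (y₁ ⊕ ⊝ y₂) ⊛ Q y₁ y₂ ≐ 𝟘
  factored n = begin
    ((y₁ ⊕ ⊝ y₂) ⊛ Q y₁ y₂) n                ≡⟨ difference-of-cubics n ⟨
    cubic 𝕏 y₁ n ℤ.+ ℤ.- cubic 𝕏 y₂ n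
                                             ≡⟨ cong₂ (λ c₁ c₂ → c₁ ℤ.+ ℤ.- c₂) (y₁-root n) (y₂-root n) ⟩
    + 0                                      ∎
    where
    open ≡-Reasoning
    difference-of-cubics : cubic 𝕏 y₁ ⊕ ⊝ cubic 𝕏 y₂ ≐ (y₁ ⊕ ⊝ y₂) ⊛ Q y₁ y₂
    difference-of-cubics = solve 3 (λ y₁ y₂ z →
        let P = λ y → y :^ 3 :+ (z :^ 2 :- con (+ 1)) :* y :^ 2 :- z :^ 4 :* y :+ z :^ 4 in
        P y₁ :- P y₂ := (y₁ :- y₂) :* (y₁ :* y₁ :+ y₁ :* y₂ :+ y₂ :* y₂
                                       :+ (z :^ 2 :- con (+ 1)) :* (y₁ :+ y₂) :- z :^ 4))
      (λ _ → refl) y₁ y₂ 𝕏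
      where open SeriesSolver
  -- As 𝕏 0 = 0, the constant term of Q only involves y₁ 0 and y₂ 0; it is 1 + 1 + 1 − 2.
  Q₀≡1 : Q y₁ y₂ 0 ≡ + 1
  Q₀≡1 = cong₂ (λ c₁ c₂ → Q (λ _ → c₁) (λ _ → c₂) 0) y₁₀≡1 y₂₀≡1
  Q₀≢0 : Q y₁ y₂ 0 ≢ + 0
  Q₀≢0 Q₀≡0 with trans (sym Q₀≡1) Q₀≡0
  ... | ()

oddPassage evenPassage : ℕ → Series
oddPassage r  = passage r climbing true
evenPassage r = passage r climbing false

oddPassage-1 : oddPassage 1 ≐ 𝕏 ⊛ (oddPassage 2 ⊕ 𝟙)
oddPassage-1 = ≐-𝕏⊛ refl (λ _ → refl)

evenPassage-1 : evenPassage 1 ≐ 𝕏 ⊛ evenPassage 2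
evenPassage-1 = ≐-𝕏⊛ refl (λ k → ℤP.+-identityʳ (evenPassage 2 k))

module PassageDecomposition (p : Bool) =
  FirstPassage (λ h m k → passage h m p k) (λ _ _ → refl) (λ _ _ _ → refl)

oddPassage-2 : oddPassage 2 ≐ oddPassage 1 ⊛ (𝕏 ⊛ oddPassage 2) ⊕ evenPassage 1 ⊛ 𝕏
oddPassage-2 = ≐-trans (PassageDecomposition.decompose true 0 1 climbing)
  (+-cong (*-congˡ {oddPassage 1} after-odd-descent) (*-congˡ {evenPassage 1} after-even-descent))
  where
  after-odd-descent : passage 1 (descending true) true ≐ 𝕏 ⊛ oddPassage 2
  after-odd-descent = ≐-𝕏⊛ refl (λ k → ℤP.+-identityʳ (oddPassage 2 k))
  after-even-descent : passage 1 (descending false) true ≐ 𝕏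
  after-even-descent = λ { 0 → refl ; 1 → refl ; (suc (suc _)) → refl }

evenPassage-2 : evenPassage 2 ≐ oddPassage 1 ⊛ (𝕏 ⊛ (evenPassage 2 ⊕ 𝟙))
evenPassage-2 = begin
  evenPassage 2
    ≈⟨ PassageDecomposition.decompose false 0 1 climbing ⟩
  oddPassage 1 ⊛ passage 1 (descending true) false ⊕ evenPassage 1 ⊛ passage 1 (descending false) false
    ≈⟨ +-cong (*-congˡ {oddPassage 1} after-odd-descent) (*-congˡ {evenPassage 1} after-even-descent) ⟩
  oddPassage 1 ⊛ (𝕏 ⊛ (evenPassage 2 ⊕ 𝟙)) ⊕ evenPassage 1 ⊛ 𝟘
    ≈⟨ +-congˡ {oddPassage 1 ⊛ (𝕏 ⊛ (evenPassage 2 ⊕ 𝟙))} (zeroʳ (evenPassage 1)) ⟩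
  oddPassage 1 ⊛ (𝕏 ⊛ (evenPassage 2 ⊕ 𝟙)) ⊕ 𝟘
    ≈⟨ +-identityʳ _ ⟩
  oddPassage 1 ⊛ (𝕏 ⊛ (evenPassage 2 ⊕ 𝟙)) ∎
  where
  open ≐-Reasoning
  after-odd-descent : passage 1 (descending true) false ≐ 𝕏 ⊛ (evenPassage 2 ⊕ 𝟙)
  after-odd-descent = ≐-𝕏⊛ refl (λ _ → refl)
  after-even-descent : passage 1 (descending false) false ≐ 𝟘
  after-even-descent = λ { 0 → refl ; (suc _) → refl }

pathsGF : Series
pathsGF k = + admissible 0 climbing k

admissible-step : ∀ h m k → + admissible (suc h) m (suc k) ≡
  when (upAllowed m) (λ k → + admissible (2 ℕ.+ h) climbing k) k
  ℤ.+ + admissible h (descending (parityAfterDown m)) k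
admissible-step h climbing           k =
  ℤP.pos-+ (admissible (2 ℕ.+ h) climbing k) (admissible h (descending true) k)
admissible-step h (descending true)  k =
  ℤP.pos-+ (admissible (2 ℕ.+ h) climbing k) (admissible h (descending false) k)
admissible-step h (descending false) k = ℤP.pos-+ 0 (admissible h (descending true) k)

module PathDecomposition = FirstPassage (λ h m k → + admissible h m k) (λ _ _ → refl) admissible-step

pathsGF-equation : pathsGF ≐ 𝟙 ⊕ 𝕏 ⊛ ((oddPassage 1 ⊕ evenPassage 1) ⊛ pathsGF)
pathsGF-equation = ≐-trans split-first-step (+-congˡ {𝟙} (*-congˡ {𝕏} (begin
  tail pathsGF
    ≈⟨ PathDecomposition.decompose 0 0 climbing ⟩
  passage 1 climbing ⊛₂ PathDecomposition.arrivals 0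
    ≈⟨ +-cong (*-congˡ {oddPassage 1} ground) (*-congˡ {evenPassage 1} ground) ⟩
  oddPassage 1 ⊛ pathsGF ⊕ evenPassage 1 ⊛ pathsGF
    ≈⟨ ⊛-distribʳ pathsGF (oddPassage 1) (evenPassage 1) ⟨
  (oddPassage 1 ⊕ evenPassage 1) ⊛ pathsGF ∎)))
  where
  open ≐-Reasoning
  split-first-step : pathsGF ≐ 𝟙 ⊕ 𝕏 ⊛ tail pathsGF
  split-first-step zero    = refl
  split-first-step (suc k) = sym (trans (ℤP.+-identityˡ _) (𝕏⊛-suc (tail pathsGF) k))
  ground : ∀ {p} → PathDecomposition.arrivals 0 p ≐ pathsGF
  ground = λ { zero → refl ; (suc _) → refl }

evenCoeff-≐ : ∀ {a G} → (∀ n → G (n ℕ.+ n) ≡ a n) → (∀ n → G (suc (n ℕ.+ n)) ≡ + 0) →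
              evenCoeff a ≐ G
evenCoeff-≐ even odd zero          = sym (even 0)
evenCoeff-≐ even odd (suc zero)    = sym (odd 0)
evenCoeff-≐ {G = G} even odd (suc (suc i)) = evenCoeff-≐ {G = G ∘ suc ∘ suc}
  (λ n → trans (cong (G ∘ suc) (sym (ℕP.+-suc n n))) (even (suc n)))
  (λ n → trans (cong (G ∘ suc ∘ suc) (sym (ℕP.+-suc n n))) (odd (suc n)))
  i

oddᵇ-1+n+n : ∀ n → oddᵇ (suc (n ℕ.+ n)) ≡ true
oddᵇ-1+n+n zero    = refl
oddᵇ-1+n+n (suc n) rewrite ℕP.+-suc n n = oddᵇ-1+n+n n

DGF≅ : DGF ≅ pathsGF ⊕ ⊝ 𝟙 /z^ 0
DGF≅ = ≅-≐ (≅-canonical DGF) (evenCoeff-≐ even odd)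
  where
  even : ∀ n → (pathsGF ⊕ ⊝ 𝟙) (n ℕ.+ n) ≡ dCoeff n
  even zero    = refl
  even (suc n) = trans (ℤP.+-identityʳ _) (cong +_ (sym (d≡admissible (suc n))))
  odd : ∀ n → (pathsGF ⊕ ⊝ 𝟙) (suc (n ℕ.+ n)) ≡ + 0
  odd n = cong (λ c → + c ℤ.+ + 0) (admissible-odd 0 climbing (suc (n ℕ.+ n)) (oddᵇ-1+n+n n))

open PassageRelations (oddPassage 1) (evenPassage 1) (oddPassage 2) (evenPassage 2) 𝕏
  oddPassage-1 evenPassage-1 oddPassage-2 evenPassage-2
open CubicElimination (oddPassage 1) (evenPassage 1) 𝕏 passage-equationₒ passage-equationₑ

cubicL : Laurent → Laurent
cubicL u = zL 1 *L u ^L 3 +L (zL 2 -L oneL) *L u ^L 2 -L zL 3 *L u +L zL 2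

cubicL≅ : ∀ {v y} → v ≅ y /z^ 1 → cubicL v ≅ 𝕏 ^ 1 ⊛ cubic 𝕏 y /z^ 3
cubicL≅ {v} {y} v≅y = ≅-≐
  (≅-+L (≅-+L (≅-+L (≅-*L (≅-zL 1) (≅-^L v≅y 3))
                    (≅-raise 1 (≅-*L (≅-+L (≅-zL 2) (≅--L (≅-zL 0))) (≅-^L v≅y 2))))
              (≅--L (≅-raise 2 (≅-*L (≅-zL 3) v≅y))))
        (≅-raise 3 (≅-zL 2)))
  (solve 2 (λ y z → z :^ 1 :* y :^ 3 :+ z :^ 1 :* ((z :^ 2 :- z :^ 0) :* y :^ 2)
                    :- z :^ 2 :* (z :^ 3 :* y) :+ z :^ 3 :* z :^ 2
                    := z :^ 1 :* (y :^ 3 :+ (z :^ 2 :- con (+ 1)) :* y :^ 2 :- z :^ 4 :* y :+ z :^ 4))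
         (λ _ → refl) y 𝕏)
  where open SeriesSolver

IsRoot⇔cubic≐𝟘 : ∀ {v y} → v ≅ y /z^ 1 → IsRoot v ⇔ (cubic 𝕏 y ≐ 𝟘)
IsRoot⇔cubic≐𝟘 {v} {y} v≅y = mk⇔ to from
  where
  zeroL≅ : zeroL ≅ 𝟘 /z^ 3
  zeroL≅ = ≅-≐ (≅-raise 3 ≅-zeroL) (zeroʳ (𝕏 ^ 3))
  to : IsRoot v → cubic 𝕏 y ≐ 𝟘
  to root = 𝕏^⊛-cancel 1
    (≐-trans (≅-injective (cubicL≅ v≅y) (≅-resp-≈ root zeroL≅)) (≐-sym (zeroʳ (𝕏 ^ 1))))
  from : cubic 𝕏 y ≐ 𝟘 → IsRoot v
  from cubic≐𝟘 =
    ≅-≈ (≅-≐ (cubicL≅ v≅y) (≐-trans (*-congˡ {𝕏 ^ 1} cubic≐𝟘) (zeroʳ (𝕏 ^ 1)))) zeroL≅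

v₁-numerator : Series
v₁-numerator = 𝟙 ⊕ ⊝ (𝕏 ⊛ oddPassage 1)

v₁ : Laurent
v₁ = laurent 1 v₁-numerator

v₁-prefix : ∀ m → m ℤ.< + 8 → coeffAt v₁ m ≡ coeffAt v1Prefix m
v₁-prefix (+ 0) _ = refl
v₁-prefix (+ 1) _ = refl
v₁-prefix (+ 2) _ = refl
v₁-prefix (+ 3) _ = refl
v₁-prefix (+ 4) _ = refl
v₁-prefix (+ 5) _ = refl
v₁-prefix (+ 6) _ = refl
v₁-prefix (+ 7) _ = refl
v₁-prefix (+ suc (suc (suc (suc (suc (suc (suc (suc _))))))))
          (ℤ.+<+ (s≤s (s≤s (s≤s (s≤s (s≤s (s≤s (s≤s (s≤s ())))))))))
v₁-prefix -[1+ 0 ]     _ = refl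
v₁-prefix -[1+ suc _ ] _ = refl

v₁-isV1 : IsV1 v₁
v₁-isV1 = Equivalence.from (IsRoot⇔cubic≐𝟘 (≅-canonical v₁)) cubic-root , v₁-prefix

IsV1⇒≅ : ∀ {w} → IsV1 w → w ≅ v₁-numerator /z^ 1
IsV1⇒≅ {w} (root , prefix) =
  ≅-≐ w≅ (cubic-root-unique (Equivalence.to (IsRoot⇔cubic≐𝟘 w≅) root) cubic-root
                            (prefix -[1+ 0 ] ℤ.-<+) refl)
  where
  below : ∀ m → m ℤ.+ + 1 ℤ.< + 0 → coeffAt w m ≡ + 0
  below (+ _)        (ℤ.+<+ ())
  below -[1+ 0 ]     (ℤ.+<+ ())
  below -[1+ suc j ] _ = prefix -[1+ suc j ] ℤ.-<+
  w≅ : w ≅ (λ n → coeffAt w (+ n ℤ.- + 1)) /z^ 1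
  w≅ = ≅-from-vanishing 1 below

dgf-identity : (v : Laurent) → IsV1 v → DGF *L (v *L (oneL -L zL 2) -L zL 1) ≈ zL 2 *L v
dgf-identity v isV1 = ≅-≈ (≅-≐ lhs≅ (paths-identity pathsGF-equation)) rhs≅
  where
  v≅ = IsV1⇒≅ isV1
  z≅ : zL 1 ≅ 𝕏 ^ 2 /z^ 1
  z≅ = ≅-≐ (≅-raise 1 (≅-zL 1)) (≐-sym (^-homo-* 𝕏 1 1))
  lhs≅ = ≅-*L DGF≅ (≅-+L (≅-*L v≅ (≅-+L (≅-zL 0) (≅--L (≅-zL 2)))) (≅--L z≅))
  rhs≅ = ≅-*L (≅-zL 2) v≅

mainTheorem5 :
    (Σ Laurent (λ v → IsV1 v × ((w : Laurent) → IsV1 w → w ≈ v)))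
    × ((v : Laurent) → IsV1 v →
         DGF *L (v *L (oneL -L zL 2) -L zL 1) ≈ zL 2 *L v)
    × (d 1 ≡ 1 × d 2 ≡ 2 × d 3 ≡ 5 × d 4 ≡ 13 × d 5 ≡ 35 × d 6 ≡ 97
       × d 7 ≡ 274 × d 8 ≡ 785)
mainTheorem5 =
  (v₁ , v₁-isV1 , λ w isV1 → ≅-≈ (IsV1⇒≅ isV1) (≅-canonical v₁))
  , dgf-identity
  , trans (d≡admissible 1) refl , trans (d≡admissible 2) refl , trans (d≡admissible 3) refl
  , trans (d≡admissible 4) refl , trans (d≡admissible 5) refl , trans (d≡admissible 6) refl
  , trans (d≡admissible 7) refl , trans (d≡admissible 8) refl
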